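{- Let $\Upsilon$ be a set of positions. Then $\mathcal{M}_{\mathrm{cl}(\Upsilon)} \cong \mathcal{M}_{\mathrm{cl}(*)}$ (as misère monoids) if and only if all of the following hold: (1) $\Upsilon$ contains a position other than $0$; (2) for every $\xi \in \mathrm{cl}(\Upsilon)$, $o^-(\xi) \in \{\mathcal{N}, \mathcal{P}\}$; (3) for every $\xi \in \mathrm{cl}(\Upsilon)$ with $o^-(\xi) = \mathcal{N}$, every Left option $\xi^L$ of $\xi$ satisfies $o^-(\xi^L) = \mathcal{P}$ and every Right option $\xi^R$ of $\xi$ satisfies $o^-(\xi^R)=\mathcal{P}$.
   Context: A position $\xi=\{\xi^L \mid \xi^R\}$ is given recursively by finite sets of Left options and Right options (finite game tree); $\cdot$ denotes an empty option set. $0=\{\cdot\mid\cdot\}$, $*=\{0\mid 0\}$. The disjunctive sum is $\alpha+\beta=\{\alpha^L+\beta,\alpha+\beta^L \mid \alpha^R+\beta,\alpha+\beta^R\}$. Under misère play a player unable to move on their turn wins. The misère outcome $o^-(\xi)$ is $\mathcal{L}$ (Left wins moving first and second), $\mathcal{R}$ (Right wins moving first and second), $\mathcal{N}$ (the player to move next wins) or $\mathcal{P}$ (the player to move next loses). A set of positions is closed if it is closed under disjunctive sum and under taking options; $\mathrm{cl}(\Upsilon)$ is the smallest closed set containing $\Upsilon$. For a closed set $\Gamma$ and $\alpha,\beta\in\Gamma$, $\alpha\equiv\beta \pmod{\Gamma}$ means $o^-(\alpha+\gamma)=o^-(\beta+\gamma)$ for all $\gamma\in\Gamma$. The misère monoid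 $\mathcal{M}_{\Gamma}$ is the commutative monoid of $\equiv$-classes of $\Gamma$ with operation induced by disjunctive sum and identity the class of $0$, equipped with the outcome tetrapartition assigning each class the (common) misère outcome of its members. Two misère monoids are isomorphic if there is a monoid isomorphism between them which, together with its inverse, preserves the outcome of every element. $\mathcal{M}_{\mathrm{cl}(*)}$ has exactly two elements $1$ (class of $0$, outcome $\mathcal{N}$) and $a$ (class of $*$, outcome $\mathcal{P}$) with $a^2=1$. -}

module Defs where

open import Data.Bool using (Bool; true; false; _∧_; _∨_)
open import Data.List using (List; []; _∷_; _++_)
open import Data.List.Membership.Propositional using (_∈_)
open import Data.Product using (Σ; _×_; _,_)
open import Relation.Binary.PropositionalEquality using (_≡_)
open import Function.Bundles using (_⇔_)

data Game : Set where
  mk : List Game → List Game → Game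

leftOpts : Game → List Game
leftOpts (mk l _) = l

rightOpts : Game → List Game
rightOpts (mk _ r) = r

zeroG : Game
zeroG = mk [] []

star : Game
star = mk (zeroG ∷ []) (zeroG ∷ [])

mutual
  _⊕_ : Game → Game → Game
  mk gl gr ⊕ mk hl hr =
    mk (mapL gl (mk hl hr) ++ mapR (mk gl gr) hl)
       (mapL gr (mk hl hr) ++ mapR (mk gl gr) hr)

  mapL : List Game → Game → List Game
  mapL [] h = []
  mapL (x ∷ xs) h = (x ⊕ h) ∷ mapL xs h

  mapR : Game → List Game → List Game
  mapR g [] = []
  mapR g (y ∷ ys) = (g ⊕ y) ∷ mapR g ys

-- Misère play.
-- leftFirst g  : Left, moving first on g, wins (misère).
-- leftSecond g : Left, moving second on g (Right starts), wins (misère).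
-- rightFirst / rightSecond symmetric.
mutual
  leftFirst : Game → Bool
  leftFirst (mk [] _) = true
  leftFirst (mk (x ∷ xs) _) = anyLeftSecond (x ∷ xs)

  leftSecond : Game → Bool
  leftSecond (mk _ []) = false
  leftSecond (mk _ (y ∷ ys)) = allLeftFirst (y ∷ ys)

  anyLeftSecond : List Game → Bool
  anyLeftSecond [] = false
  anyLeftSecond (x ∷ xs) = leftSecond x ∨ anyLeftSecond xs

  allLeftFirst : List Game → Bool
  allLeftFirst [] = true
  allLeftFirst (x ∷ xs) = leftFirst x ∧ allLeftFirst xs

data Outcome : Set where
  𝓛 𝓝 𝓟 𝓡 : Outcome

-- Misère outcome.  By determinacy of finite games, Right wins moving
-- first iff Left does not win moving second, and Right wins moving second
-- iff Left does not win moving first.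
outcomeFrom : Bool → Bool → Outcome
outcomeFrom true  true  = 𝓛
outcomeFrom true  false = 𝓝
outcomeFrom false true  = 𝓟
outcomeFrom false false = 𝓡

o⁻ : Game → Outcome
o⁻ g = outcomeFrom (leftFirst g) (leftSecond g)

data Cl (Υ : Game → Set) : Game → Set where
  base : ∀ {g} → Υ g → Cl Υ g
  sum  : ∀ {g h} → Cl Υ g → Cl Υ h → Cl Υ (g ⊕ h)
  optL : ∀ {g x} → Cl Υ g → x ∈ leftOpts g → Cl Υ x
  optR : ∀ {g x} → Cl Υ g → x ∈ rightOpts g → Cl Υ x

_≡[_]_ : Game → (Game → Set) → Game → Set
α ≡[ Υ ] β = ∀ γ → Cl Υ γ → o⁻ (α ⊕ γ) ≡ o⁻ (β ⊕ γ)

-- An isomorphism of misère monoids M_{cl(Υ)} ≅ M_{cl(Υ')}, presented on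
-- representatives: f is a map on cl(Υ) which induces a well-defined,
-- injective (resp) and surjective (surj) map on ≡-classes, preserves the
-- identity (class of 0, which must lie in both closed sets for the monoids
-- to be defined) and sums, and preserves outcomes.  (Outcome preservation of
-- the inverse then follows since outcome is constant on classes.)
record MisereIso (Υ Υ' : Game → Set) : Set where
  field
    f       : (α : Game) → Cl Υ α → Game
    f-in    : ∀ α (p : Cl Υ α) → Cl Υ' (f α p)
    zero-in  : Cl Υ zeroG
    zero-in' : Cl Υ' zeroG
    resp    : ∀ α β (p : Cl Υ α) (q : Cl Υ β) →
              (α ≡[ Υ ] β) ⇔ (f α p ≡[ Υ' ] f β q)
    surj    : ∀ δ → Cl Υ' δ → Σ Game λ α → Σ (Cl Υ α) λ p → f α p ≡[ Υ' ] δ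
    unit    : f zeroG zero-in ≡[ Υ' ] zeroG
    hom     : ∀ α β (p : Cl Υ α) (q : Cl Υ β) →
              f (α ⊕ β) (sum p q) ≡[ Υ' ] (f α p ⊕ f β q)
    outc    : ∀ α (p : Cl Υ α) → o⁻ (f α p) ≡ o⁻ α
    outc⁻¹  : ∀ α (p : Cl Υ α) δ → Cl Υ' δ → f α p ≡[ Υ' ] δ → o⁻ δ ≡ o⁻ α

IsStar : Game → Set
IsStar g = g ≡ star

module Submission where

-- The proof revolves around *parity-like* positions: a position behaves
-- like 0 ("zero-like") when all its options are star-like, and like *
-- ("star-like") when it has a Left and a Right option and all its options
-- are zero-like.  Such positions add like the elements of ℤ/2 (parity of a
-- sum is the xor of the parities), and a parity-like position of parity b
-- has misère outcome 𝓝 (b = false) or 𝓟 (b = true).  Consequently, in a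
-- closed set all of whose positions are parity-like, two positions are
-- equivalent exactly when they have the same parity.
--
-- For "⇐", conditions (2) and (3) make every position of
-- cl(Υ) parity-like, and mapping a position to 0 or * by its parity is an
-- isomorphism onto M_{cl(*)}.  For "⇒", the isomorphism transports outcomes
-- from cl(*), where every position is parity-like, giving (2); a preimage τ
-- of * is a nonzero 𝓟-position, giving (1); and adding τ turns 𝓝-positions
-- into 𝓟-positions, which rules out 𝓝-options of 𝓝-positions, giving (3).

open import Defs
open import Data.Bool using (Bool; true; false; not; _xor_; _∨_; _∧_)
open import Data.Bool.Properties using (∨-zeroʳ; ∧-zeroʳ; xor-identityʳ)
open import Data.Empty using (⊥-elim)
open import Data.List using (List; []; _∷_; _++_)
open import Data.List.Membership.Propositional using (_∈_)
open import Data.List.Relation.Unary.All using (All; []; _∷_; lookup)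
open import Data.List.Relation.Unary.All.Properties using (++⁺)
open import Data.List.Relation.Unary.Any using (here; there)
open import Data.List.Relation.Unary.Any.Properties using (¬Any[])
open import Data.List.Membership.Propositional.Properties using (∈-++⁺ˡ)
open import Data.Product using (Σ; _×_; _,_; proj₁; proj₂)
open import Data.Sum using (_⊎_; inj₁; inj₂)
open import Relation.Nullary using (Dec; yes; no)
open import Relation.Binary.PropositionalEquality
  using (_≡_; _≢_; refl; sym; trans; cong; cong₂; subst; module ≡-Reasoning)
open import Function.Bundles using (_⇔_; mk⇔; Equivalence)
import Function.Properties.Equivalence as ⇔

true≢false : true ≢ false
true≢false ()

∈-mapL : ∀ {x l} h → x ∈ l → (x ⊕ h) ∈ mapL l h
∈-mapL h (here refl) = here refl
∈-mapL h (there m)   = there (∈-mapL h m)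

leftOption-⊕ : ∀ {g h x} → x ∈ leftOpts g → (x ⊕ h) ∈ leftOpts (g ⊕ h)
leftOption-⊕ {mk _ _} {mk hl hr} m = ∈-++⁺ˡ (∈-mapL (mk hl hr) m)

rightOption-⊕ : ∀ {g h x} → x ∈ rightOpts g → (x ⊕ h) ∈ rightOpts (g ⊕ h)
rightOption-⊕ {mk _ _} {mk hl hr} m = ∈-++⁺ˡ (∈-mapL (mk hl hr) m)

leftFirst-option : ∀ {g x} → x ∈ leftOpts g → leftSecond x ≡ true →
                   leftFirst g ≡ true
leftFirst-option {mk (_ ∷ _) _} m e = go m e
  where
  go : ∀ {x l} → x ∈ l → leftSecond x ≡ true → anyLeftSecond l ≡ true
  go (here refl) e = cong (_∨ _) e
  go {l = y ∷ _} (there m) e =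
    trans (cong (leftSecond y ∨_) (go m e)) (∨-zeroʳ (leftSecond y))

leftSecond-option : ∀ {g x} → x ∈ rightOpts g → leftFirst x ≡ false →
                    leftSecond g ≡ false
leftSecond-option {mk _ (_ ∷ _)} m e = go m e
  where
  go : ∀ {x l} → x ∈ l → leftFirst x ≡ false → allLeftFirst l ≡ false
  go (here refl) e = cong (_∧ _) e
  go {l = y ∷ _} (there m) e =
    trans (cong (leftFirst y ∧_) (go m e)) (∧-zeroʳ (leftFirst y))

outcome-𝓟 : ∀ a b → outcomeFrom a b ≡ 𝓟 → (a ≡ false) × (b ≡ true)
outcome-𝓟 false true _ = refl , refl
outcome-𝓟 true  true  ()
outcome-𝓟 true  false ()
outcome-𝓟 false false ()

𝓟⇒leftFirst : ∀ {g} → o⁻ g ≡ 𝓟 → leftFirst g ≡ false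
𝓟⇒leftFirst {g} e = proj₁ (outcome-𝓟 (leftFirst g) (leftSecond g) e)

𝓟⇒leftSecond : ∀ {g} → o⁻ g ≡ 𝓟 → leftSecond g ≡ true
𝓟⇒leftSecond {g} e = proj₂ (outcome-𝓟 (leftFirst g) (leftSecond g) e)

-- A 𝓟-position has no 𝓟-option: moving to it would win.
𝓟-leftOption : ∀ {g x} → x ∈ leftOpts g → o⁻ x ≡ 𝓟 → o⁻ g ≢ 𝓟
𝓟-leftOption {g} {x} m px pg =
  true≢false (trans (sym (leftFirst-option {g} m (𝓟⇒leftSecond {x} px)))
                    (𝓟⇒leftFirst {g} pg))

𝓟-rightOption : ∀ {g x} → x ∈ rightOpts g → o⁻ x ≡ 𝓟 → o⁻ g ≢ 𝓟
𝓟-rightOption {g} {x} m px pg =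
  true≢false (trans (sym (𝓟⇒leftSecond {g} pg))
                    (leftSecond-option {g} m (𝓟⇒leftFirst {x} px)))

-- Star-like positions need at least one option on each side.
data NonEmpty : List Game → Set where
  nonEmpty : ∀ {x xs} → NonEmpty (x ∷ xs)

-- Parity false g: g behaves like 0;  Parity true g: g behaves like *.
data Parity : Bool → Game → Set where
  zeroLike : ∀ {l r} → All (Parity true) l → All (Parity true) r →
             Parity false (mk l r)
  starLike : ∀ {l r} → All (Parity false) l → All (Parity false) r →
             NonEmpty l → NonEmpty r → Parity true (mk l r)

parity-0 : Parity false zeroG
parity-0 = zeroLike [] []

parity-* : Parity true star
parity-* = starLike (parity-0 ∷ []) (parity-0 ∷ []) nonEmpty nonEmpty

parity-leftOption : ∀ {b g x} → Parity b g → x ∈ leftOpts g → Parity (not b) x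
parity-leftOption (zeroLike pl _)     m = lookup pl m
parity-leftOption (starLike pl _ _ _) m = lookup pl m

parity-rightOption : ∀ {b g x} → Parity b g → x ∈ rightOpts g → Parity (not b) x
parity-rightOption (zeroLike _ pr)     m = lookup pr m
parity-rightOption (starLike _ pr _ _) m = lookup pr m

-- Left wins moving first on a zero-like position (she has no move or moves
-- to a star-like one) and loses moving first on a star-like one; dually
-- for moving second.
mutual
  leftFirst-parity : ∀ {b g} → Parity b g → leftFirst g ≡ not b
  leftFirst-parity (zeroLike {[]} _ _)            = refl
  leftFirst-parity (zeroLike {_ ∷ _} (px ∷ _) _)  = cong (_∨ _) (leftSecond-parity px)
  leftFirst-parity (starLike pl _ nonEmpty _)     = noLeftSecond pl

  leftSecond-parity : ∀ {b g} → Parity b g → leftSecond g ≡ b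
  leftSecond-parity (zeroLike {r = []} _ _)           = refl
  leftSecond-parity (zeroLike {r = _ ∷ _} _ (px ∷ _)) = cong (_∧ _) (leftFirst-parity px)
  leftSecond-parity (starLike _ pr _ nonEmpty)        = allLeftFirst-parity pr

  noLeftSecond : ∀ {l} → All (Parity false) l → anyLeftSecond l ≡ false
  noLeftSecond []         = refl
  noLeftSecond (px ∷ pxs) = cong₂ _∨_ (leftSecond-parity px) (noLeftSecond pxs)

  allLeftFirst-parity : ∀ {l} → All (Parity false) l → allLeftFirst l ≡ true
  allLeftFirst-parity []         = refl
  allLeftFirst-parity (px ∷ pxs) = cong₂ _∧_ (leftFirst-parity px) (allLeftFirst-parity pxs)

parityOutcome : Bool → Outcome
parityOutcome false = 𝓝
parityOutcome true  = 𝓟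

isP : Outcome → Bool
isP 𝓟 = true
isP _ = false

isP-parityOutcome : ∀ b → isP (parityOutcome b) ≡ b
isP-parityOutcome false = refl
isP-parityOutcome true  = refl

parityOutcome-injective : ∀ {b c} → parityOutcome b ≡ parityOutcome c → b ≡ c
parityOutcome-injective {b} {c} e =
  trans (sym (isP-parityOutcome b)) (trans (cong isP e) (isP-parityOutcome c))

parityOutcome-isP : ∀ {o} → (o ≡ 𝓝) ⊎ (o ≡ 𝓟) → parityOutcome (isP o) ≡ o
parityOutcome-isP (inj₁ refl) = refl
parityOutcome-isP (inj₂ refl) = refl

outcome-parity : ∀ {b g} → Parity b g → o⁻ g ≡ parityOutcome b
outcome-parity {false} p rewrite leftFirst-parity p | leftSecond-parity p = refl
outcome-parity {true}  p rewrite leftFirst-parity p | leftSecond-parity p = refl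

parity-unique : ∀ {b c g} → Parity b g → Parity c g → b ≡ c
parity-unique pb pc = trans (sym (leftSecond-parity pb)) (leftSecond-parity pc)

nonEmpty-mapL : ∀ {l} h → NonEmpty l → NonEmpty (mapL l h)
nonEmpty-mapL h nonEmpty = nonEmpty

nonEmpty-mapR : ∀ {l} g → NonEmpty l → NonEmpty (mapR g l)
nonEmpty-mapR g nonEmpty = nonEmpty

nonEmpty-++ˡ : ∀ {xs} ys → NonEmpty xs → NonEmpty (xs ++ ys)
nonEmpty-++ˡ ys nonEmpty = nonEmpty

nonEmpty-++ʳ : ∀ xs {ys} → NonEmpty ys → NonEmpty (xs ++ ys)
nonEmpty-++ʳ []       n = n
nonEmpty-++ʳ (_ ∷ _) n = nonEmpty

mutual
  parity-⊕ : ∀ {b c g h} → Parity b g → Parity c h → Parity (b xor c) (g ⊕ h)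
  parity-⊕ pg@(zeroLike pl pr) ph@(zeroLike ql qr) =
    zeroLike (++⁺ (parity-mapL pl ph) (parity-mapR pg ql))
             (++⁺ (parity-mapL pr ph) (parity-mapR pg qr))
  parity-⊕ {g = mk gl gr} pg@(zeroLike pl pr) ph@(starLike ql qr nl nr) =
    starLike (++⁺ (parity-mapL pl ph) (parity-mapR pg ql))
             (++⁺ (parity-mapL pr ph) (parity-mapR pg qr))
             (nonEmpty-++ʳ (mapL gl _) (nonEmpty-mapR _ nl))
             (nonEmpty-++ʳ (mapL gr _) (nonEmpty-mapR _ nr))
  parity-⊕ {h = mk hl hr} pg@(starLike pl pr nl nr) ph@(zeroLike ql qr) =
    starLike (++⁺ (parity-mapL pl ph) (parity-mapR pg ql))
             (++⁺ (parity-mapL pr ph) (parity-mapR pg qr))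
             (nonEmpty-++ˡ _ (nonEmpty-mapL _ nl))
             (nonEmpty-++ˡ _ (nonEmpty-mapL _ nr))
  parity-⊕ pg@(starLike pl pr _ _) ph@(starLike ql qr _ _) =
    zeroLike (++⁺ (parity-mapL pl ph) (parity-mapR pg ql))
             (++⁺ (parity-mapL pr ph) (parity-mapR pg qr))

  parity-mapL : ∀ {b c l h} → All (Parity b) l → Parity c h →
                All (Parity (b xor c)) (mapL l h)
  parity-mapL []         ph = []
  parity-mapL (px ∷ pxs) ph = parity-⊕ px ph ∷ parity-mapL pxs ph

  parity-mapR : ∀ {b c g l} → Parity b g → All (Parity c) l →
                All (Parity (b xor c)) (mapR g l)
  parity-mapR pg []         = []
  parity-mapR pg (py ∷ pys) = parity-⊕ pg py ∷ parity-mapR pg pys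

ParityClosed : (Game → Set) → Set
ParityClosed S = ∀ γ → Cl S γ → Σ Bool λ b → Parity b γ

-- If cl(S) consists of parity-like positions and contains 0, equivalence
-- modulo cl(S) of parity-like positions is equality of parities: sums with
-- γ have outcome determined by the parities, and γ = 0 separates them.
equivalent⇔sameParity : ∀ {S b c α β} → ParityClosed S → Cl S zeroG →
                        Parity b α → Parity c β → (α ≡[ S ] β) ⇔ (b ≡ c)
equivalent⇔sameParity {S} {b} {c} {α} {β} pc z pα pβ = mk⇔ same equivalent
  where
  same : α ≡[ S ] β → b ≡ c
  same e = cancel-xor-false (parityOutcome-injective
    (trans (sym (outcome-parity (parity-⊕ pα parity-0)))
           (trans (e zeroG z) (outcome-parity (parity-⊕ pβ parity-0)))))
    where
    cancel-xor-false : b xor false ≡ c xor false → b ≡ c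
    cancel-xor-false e′ = trans (sym (xor-identityʳ b)) (trans e′ (xor-identityʳ c))

  equivalent : b ≡ c → α ≡[ S ] β
  equivalent refl γ pγ with pc γ pγ
  ... | d , pd = trans (outcome-parity (parity-⊕ pα pd))
                       (sym (outcome-parity (parity-⊕ pβ pd)))

parityClosed-* : ParityClosed IsStar
parityClosed-* _ (base refl) = true , parity-*
parityClosed-* _ (sum p q) with parityClosed-* _ p | parityClosed-* _ q
... | b , pb | c , pc = b xor c , parity-⊕ pb pc
parityClosed-* _ (optL p m) with parityClosed-* _ p
... | b , pb = not b , parity-leftOption pb m
parityClosed-* _ (optR p m) with parityClosed-* _ p
... | b , pb = not b , parity-rightOption pb m

-- Repeatedly taking options reaches 0.
zero-in-closure : ∀ {S} g → Cl S g → Cl S zeroG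
zero-in-closure (mk []      [])      p = p
zero-in-closure (mk (x ∷ _) _)       p = zero-in-closure x (optL p (here refl))
zero-in-closure (mk []      (y ∷ _)) p = zero-in-closure y (optR p (here refl))

zero? : (g : Game) → Dec (g ≡ zeroG)
zero? (mk []      [])      = yes refl
zero? (mk (_ ∷ _) _)       = no λ ()
zero? (mk []      (_ ∷ _)) = no λ ()

-- 0 + 0 = 0 and 0 has no options, so a nonzero element of cl(S) is built
-- from a nonzero element of S.
nonzero-generator : ∀ {S g} → Cl S g → g ≢ zeroG →
                    Σ Game λ ξ → S ξ × ξ ≢ zeroG
nonzero-generator (base u) nz = _ , u , nz
nonzero-generator (sum {g} {h} p q) nz with zero? g | zero? h
... | no g≢0   | _        = nonzero-generator p g≢0
... | yes _    | no h≢0   = nonzero-generator q h≢0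
... | yes refl | yes refl = ⊥-elim (nz refl)
nonzero-generator (optL p m) nz = nonzero-generator p λ { refl → ¬Any[] m }
nonzero-generator (optR p m) nz = nonzero-generator p λ { refl → ¬Any[] m }

-- If cl(Υ) is parity-closed, contains 0 and a star-like position, then
-- sending each position to 0 or * according to its parity is an
-- isomorphism M_{cl(Υ)} ≅ M_{cl(*)}.
module ParityIso (Υ : Game → Set) (pc : ParityClosed Υ) (z : Cl Υ zeroG)
                 (σ : Game) (σ∈ : Cl Υ σ) (σ-star : Parity true σ) where

  parity : ∀ α → Cl Υ α → Bool
  parity α p = proj₁ (pc α p)

  parity-of : ∀ α (p : Cl Υ α) → Parity (parity α p) α
  parity-of α p = proj₂ (pc α p)

  starPower : Bool → Game
  starPower false = zeroG
  starPower true  = star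

  starPower-parity : ∀ b → Parity b (starPower b)
  starPower-parity false = parity-0
  starPower-parity true  = parity-*

  starPower-in : ∀ b → Cl IsStar (starPower b)
  starPower-in false = optL (base refl) (here refl)
  starPower-in true  = base refl

  equivΥ : ∀ {b c α β} → Parity b α → Parity c β → (α ≡[ Υ ] β) ⇔ (b ≡ c)
  equivΥ = equivalent⇔sameParity pc z

  equiv* : ∀ {b c α β} → Parity b α → Parity c β → (α ≡[ IsStar ] β) ⇔ (b ≡ c)
  equiv* = equivalent⇔sameParity parityClosed-* (starPower-in false)

  realise : ∀ b → Σ Game λ α → Cl Υ α × Parity b α
  realise false = zeroG , z , parity-0
  realise true  = σ , σ∈ , σ-star

  iso : MisereIso Υ IsStar
  iso = record
    { f        = λ α p → starPower (parity α p)
    ; f-in     = λ α p → starPower-in (parity α p)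
    ; zero-in  = z
    ; zero-in' = starPower-in false
    ; resp     = λ α β p q → ⇔.trans (equivΥ (parity-of α p) (parity-of β q))
                   (⇔.sym (equiv* (starPower-parity _) (starPower-parity _)))
    ; surj     = surj
    ; unit     = Equivalence.from (equiv* (starPower-parity (parity zeroG z)) parity-0)
                   (parity-unique (parity-of zeroG z) parity-0)
    ; hom      = λ α β p q → Equivalence.from
                   (equiv* (starPower-parity (parity (α ⊕ β) (sum p q)))
                           (parity-⊕ (starPower-parity (parity α p))
                                     (starPower-parity (parity β q))))
                   (parity-unique (parity-of (α ⊕ β) (sum p q))
                                  (parity-⊕ (parity-of α p) (parity-of β q)))
    ; outc     = λ α p → trans (outcome-parity (starPower-parity _))
                               (sym (outcome-parity (parity-of α p)))
    ; outc⁻¹   = outc⁻¹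
    }
    where
    surj : ∀ δ → Cl IsStar δ →
           Σ Game λ α → Σ (Cl Υ α) λ p → starPower (parity α p) ≡[ IsStar ] δ
    surj δ pδ with parityClosed-* δ pδ
    ... | b , δ-b with realise b
    ...   | α , p , α-b = α , p , Equivalence.from
                            (equiv* (starPower-parity _) δ-b)
                            (parity-unique (parity-of α p) α-b)

    outc⁻¹ : ∀ α (p : Cl Υ α) δ → Cl IsStar δ →
             starPower (parity α p) ≡[ IsStar ] δ → o⁻ δ ≡ o⁻ α
    outc⁻¹ α p δ pδ e with parityClosed-* δ pδ
    ... | b , δ-b = trans (outcome-parity δ-b)
      (trans (cong parityOutcome (sym (Equivalence.to (equiv* (starPower-parity _) δ-b) e)))
             (sym (outcome-parity (parity-of α p))))

NonzeroGenerator : (Game → Set) → Set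
NonzeroGenerator Υ = Σ Game λ ξ → Υ ξ × ξ ≢ zeroG

OutcomesNP : (Game → Set) → Set
OutcomesNP Υ = ∀ ξ → Cl Υ ξ → (o⁻ ξ ≡ 𝓝) ⊎ (o⁻ ξ ≡ 𝓟)

OptionsOf𝓝Are𝓟 : (Game → Set) → Set
OptionsOf𝓝Are𝓟 Υ = ∀ ξ → Cl Υ ξ → o⁻ ξ ≡ 𝓝 →
  (∀ ξL → ξL ∈ leftOpts ξ → o⁻ ξL ≡ 𝓟) × (∀ ξR → ξR ∈ rightOpts ξ → o⁻ ξR ≡ 𝓟)

-- Under (2) and (3) the positions of cl(Υ) are parity-like, with parity
-- "is a 𝓟-position": options of 𝓝-positions are 𝓟 by (3), options of
-- 𝓟-positions are 𝓝 by (2) since a 𝓟-position has no 𝓟-option, and a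
-- 𝓟-position has options on both sides since a player without moves wins.
module FromConditions (Υ : Game → Set) (np : OutcomesNP Υ)
                      (n-opts : OptionsOf𝓝Are𝓟 Υ) where

  leftOption-of-𝓟 : ∀ {ξ x} → Cl Υ ξ → o⁻ ξ ≡ 𝓟 → x ∈ leftOpts ξ → o⁻ x ≡ 𝓝
  leftOption-of-𝓟 {ξ} {x} p e m with np x (optL p m)
  ... | inj₁ n = n
  ... | inj₂ q = ⊥-elim (𝓟-leftOption {ξ} m q e)

  rightOption-of-𝓟 : ∀ {ξ x} → Cl Υ ξ → o⁻ ξ ≡ 𝓟 → x ∈ rightOpts ξ → o⁻ x ≡ 𝓝
  rightOption-of-𝓟 {ξ} {x} p e m with np x (optR p m)
  ... | inj₁ n = n
  ... | inj₂ q = ⊥-elim (𝓟-rightOption {ξ} m q e)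

  -- Left moving first loses, so she has a move; Right moving first
  -- loses, so he has a move.
  leftOpts-nonEmpty : ∀ {l r} → leftFirst (mk l r) ≡ false → NonEmpty l
  leftOpts-nonEmpty {_ ∷ _} _ = nonEmpty

  rightOpts-nonEmpty : ∀ {l r} → leftSecond (mk l r) ≡ true → NonEmpty r
  rightOpts-nonEmpty {r = _ ∷ _} _ = nonEmpty

  mutual
    parity-from-outcome : ∀ b ξ → Cl Υ ξ → o⁻ ξ ≡ parityOutcome b → Parity b ξ
    parity-from-outcome false (mk l r) p e =
      zeroLike (parities l (optL p) (proj₁ (n-opts _ p e) _))
               (parities r (optR p) (proj₂ (n-opts _ p e) _))
    parity-from-outcome true (mk l r) p e =
      starLike (parities l (optL p) (leftOption-of-𝓟 p e))
               (parities r (optR p) (rightOption-of-𝓟 p e))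
               (leftOpts-nonEmpty (𝓟⇒leftFirst {mk l r} e))
               (rightOpts-nonEmpty (𝓟⇒leftSecond {mk l r} e))

    parities : ∀ {b} l → (∀ {x} → x ∈ l → Cl Υ x) →
               (∀ {x} → x ∈ l → o⁻ x ≡ parityOutcome b) → All (Parity b) l
    parities []       _ _ = []
    parities (x ∷ xs) c e =
      parity-from-outcome _ x (c (here refl)) (e (here refl))
        ∷ parities xs (λ m → c (there m)) (λ m → e (there m))

  parityClosed : ParityClosed Υ
  parityClosed ξ p = isP (o⁻ ξ) ,
    parity-from-outcome _ ξ p (sym (parityOutcome-isP (np ξ p)))

  starLike-below : ∀ {b ξ} → Parity b ξ → Cl Υ ξ → ξ ≢ zeroG →
                   Σ Game λ σ → Cl Υ σ × Parity true σ
  starLike-below p@(starLike _ _ _ _)                  c _  = _ , c , p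
  starLike-below (zeroLike {_ ∷ _} (px ∷ _) _)          c _  = _ , optL c (here refl) , px
  starLike-below (zeroLike {[]} {_ ∷ _} _ (px ∷ _))     c _  = _ , optR c (here refl) , px
  starLike-below (zeroLike {[]} {[]} _ _)               _ nz = ⊥-elim (nz refl)

  iso : NonzeroGenerator Υ → MisereIso Υ IsStar
  iso (ξ , u , nz) with starLike-below (proj₂ (parityClosed ξ (base u))) (base u) nz
  ... | σ , σ∈ , σ-star =
    ParityIso.iso Υ parityClosed (zero-in-closure ξ (base u)) σ σ∈ σ-star

module FromIso (Υ : Game → Set) (I : MisereIso Υ IsStar) where
  open MisereIso I

  image-parity : ∀ α (p : Cl Υ α) → Parity (isP (o⁻ α)) (f α p)
  image-parity α p with parityClosed-* (f α p) (f-in α p)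
  ... | b , pb = subst (λ c → Parity c (f α p))
    (trans (sym (isP-parityOutcome b)) (cong isP (trans (sym (outcome-parity pb)) (outc α p))))
    pb

  outcomesNP : OutcomesNP Υ
  outcomesNP ξ p with isP (o⁻ ξ) | outcome-parity (image-parity ξ p)
  ... | false | e = inj₁ (trans (sym (outc ξ p)) e)
  ... | true  | e = inj₂ (trans (sym (outc ξ p)) e)

  τ : Game
  τ = proj₁ (surj star (base refl))

  τ∈ : Cl Υ τ
  τ∈ = proj₁ (proj₂ (surj star (base refl)))

  τ-𝓟 : o⁻ τ ≡ 𝓟
  τ-𝓟 = sym (outc⁻¹ τ τ∈ star (base refl) (proj₂ (proj₂ (surj star (base refl)))))

  nonzero : NonzeroGenerator Υ
  nonzero = nonzero-generator τ∈ λ τ≡0 → 𝓝≢𝓟 (trans (sym (cong o⁻ τ≡0)) τ-𝓟)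
    where
    𝓝≢𝓟 : 𝓝 ≢ 𝓟
    𝓝≢𝓟 ()

  ⊕τ-𝓟 : ∀ α → Cl Υ α → o⁻ α ≡ 𝓝 → o⁻ (α ⊕ τ) ≡ 𝓟
  ⊕τ-𝓟 α p e = begin
    o⁻ (α ⊕ τ)
      ≡⟨ sym (outc⁻¹ (α ⊕ τ) (sum p τ∈) (f α p ⊕ f τ τ∈)
                     (sum (f-in α p) (f-in τ τ∈)) (hom α τ p τ∈)) ⟩
    o⁻ (f α p ⊕ f τ τ∈)
      ≡⟨ outcome-parity (parity-⊕ (image-parity α p) (image-parity τ τ∈)) ⟩
    parityOutcome (isP (o⁻ α) xor isP (o⁻ τ))
      ≡⟨ cong₂ (λ a t → parityOutcome (isP a xor isP t)) e τ-𝓟 ⟩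
    𝓟 ∎
    where open ≡-Reasoning

  -- An 𝓝-option ξ' of an 𝓝-position ξ would make ξ' + τ a 𝓟-option of
  -- the 𝓟-position ξ + τ.
  optionsOf𝓝Are𝓟 : OptionsOf𝓝Are𝓟 Υ
  optionsOf𝓝Are𝓟 ξ p e = left , right
    where
    left : ∀ ξL → ξL ∈ leftOpts ξ → o⁻ ξL ≡ 𝓟
    left ξL m with outcomesNP ξL (optL p m)
    ... | inj₂ q = q
    ... | inj₁ n = ⊥-elim (𝓟-leftOption {ξ ⊕ τ} (leftOption-⊕ {ξ} {τ} m)
                             (⊕τ-𝓟 ξL (optL p m) n) (⊕τ-𝓟 ξ p e))

    right : ∀ ξR → ξR ∈ rightOpts ξ → o⁻ ξR ≡ 𝓟
    right ξR m with outcomesNP ξR (optR p m)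
    ... | inj₂ q = q
    ... | inj₁ n = ⊥-elim (𝓟-rightOption {ξ ⊕ τ} (rightOption-⊕ {ξ} {τ} m)
                              (⊕τ-𝓟 ξR (optR p m) n) (⊕τ-𝓟 ξ p e))

theorem7p3p6 : (Υ : Game → Set) →
    MisereIso Υ IsStar ⇔
      ((Σ Game λ ξ → Υ ξ × ξ ≢ zeroG)
       × (∀ ξ → Cl Υ ξ → (o⁻ ξ ≡ 𝓝) ⊎ (o⁻ ξ ≡ 𝓟))
       × (∀ ξ → Cl Υ ξ → o⁻ ξ ≡ 𝓝 →
            (∀ ξL → ξL ∈ leftOpts ξ → o⁻ ξL ≡ 𝓟)
            × (∀ ξR → ξR ∈ rightOpts ξ → o⁻ ξR ≡ 𝓟)))
theorem7p3p6 Υ = mk⇔ conditions isomorphism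
  where
  conditions : MisereIso Υ IsStar →
               NonzeroGenerator Υ × OutcomesNP Υ × OptionsOf𝓝Are𝓟 Υ
  conditions I = nonzero , outcomesNP , optionsOf𝓝Are𝓟
    where open FromIso Υ I

  isomorphism : NonzeroGenerator Υ × OutcomesNP Υ × OptionsOf𝓝Are𝓟 Υ →
                MisereIso Υ IsStar
  isomorphism (nz , np , n-opts) = FromConditions.iso Υ np n-opts nz
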